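{- Let $a,b$ be relatively prime positive integers, $n\ge1$, and let $\pi$ be an $(a,b)$-Dyck path of size $n$. For $i\in[1,b]$ and $j\in[1,a]$, let $r^{hv}_{i,j}$ be the $j$-th path of $\theta_v(p_i)$, where $\theta_h(\pi)=(p_1,\dots,p_b)$, and let $r^{vh}_{i,j}$ be the $i$-th path of $\theta_h(q_j)$, where $\theta_v(\pi)=(q_1,\dots,q_a)$. Then $r^{hv}_{i,j}=r^{vh}_{i,j}$ for all $i\in[1,b]$, $j\in[1,a]$; that is, $\theta_h\circ\theta_v=\theta_v\circ\theta_h$.
   Context: Lattice paths use unit steps $N=(0,1)$, $E=(1,0)$. An $(a,b)$-Dyck path of size $n$ goes from $(0,0)$ to $(bn,an)$ and never goes below $y=ax/b$. Step sequence of a path with $A$ north steps: $(u_1,\dots,u_A)$, $u_k$ the $x$-coordinate of the $k$-th north step. Height sequence of a path with $B$ east steps: $(h_1,\dots,h_B)$, $h_k$ the $y$-coordinate of the $k$-th east step. Horizontal strip decomposition $\theta_h$: for a lattice path from $(0,0)$ to $(bn,m)$ with height sequence $(h_1,\dots,h_{bn})$, $\theta_h$ returns the $b$ paths $p_1,\dots,p_b$ from $(0,0)$ to $(n,m)$, where $p_i$ has height sequence $(h_{(k-1)b+i})_{k=1}^{n}$. Vertical strip decomposition $\theta_v$: for a lattice path from $(0,0)$ to $(m,an)$ with step sequence $(u_1,\dots,u_{an})$, $\theta_v$ returns the $a$ paths $q_1,\dots,q_a$ from $(0,0)$ to $(m,n)$, where $q_j$ has step sequence $(u_{(k-1)a+j})_{k=1}^{n}$.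 Both maps are applied componentwise to tuples of paths. -}

module Defs where

open import Data.Nat using (ℕ; zero; suc; _+_; _*_; _∸_; _≤_)
open import Data.List using (List; []; _∷_; _++_; map; replicate; upTo; take; length)
open import Data.Fin using (Fin; toℕ)
open import Relation.Binary.PropositionalEquality using (_≡_)

-- Unit steps: N = (0,1), E = (1,0).  A lattice path starting at (0,0)
-- is a word in N and E.
data Step : Set where
  N E : Step

Path : Set
Path = List Step

#E : Path → ℕ
#E [] = 0
#E (E ∷ p) = suc (#E p)
#E (N ∷ p) = #E p

#N : Path → ℕ
#N [] = 0
#N (N ∷ p) = suc (#N p)
#N (E ∷ p) = #N p

stepSeqFrom : ℕ → Path → List ℕ
stepSeqFrom x [] = []
stepSeqFrom x (N ∷ p) = x ∷ stepSeqFrom x p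
stepSeqFrom x (E ∷ p) = stepSeqFrom (suc x) p

stepSeq : Path → List ℕ
stepSeq = stepSeqFrom 0

heightSeqFrom : ℕ → Path → List ℕ
heightSeqFrom y [] = []
heightSeqFrom y (E ∷ p) = y ∷ heightSeqFrom y p
heightSeqFrom y (N ∷ p) = heightSeqFrom (suc y) p

heightSeq : Path → List ℕ
heightSeq = heightSeqFrom 0

-- The unique path from (0,0) to (length hs, m) with height sequence hs
-- (for hs weakly increasing with entries ≤ m).
fromHeightsFrom : ℕ → ℕ → List ℕ → Path
fromHeightsFrom m c [] = replicate (m ∸ c) N
fromHeightsFrom m c (h ∷ hs) = replicate (h ∸ c) N ++ (E ∷ fromHeightsFrom m h hs)

fromHeights : ℕ → List ℕ → Path
fromHeights m = fromHeightsFrom m 0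

-- The unique path from (0,0) to (m, length us) with step sequence us
-- (for us weakly increasing with entries ≤ m).
fromStepsFrom : ℕ → ℕ → List ℕ → Path
fromStepsFrom m c [] = replicate (m ∸ c) E
fromStepsFrom m c (u ∷ us) = replicate (u ∸ c) E ++ (N ∷ fromStepsFrom m u us)

fromSteps : ℕ → List ℕ → Path
fromSteps m = fromStepsFrom m 0

-- 0-indexed list lookup with default 0 (only used in range below).
nth : List ℕ → ℕ → ℕ
nth [] _ = 0
nth (x ∷ xs) zero = x
nth (x ∷ xs) (suc k) = nth xs k

-- Horizontal strip decomposition of a path from (0,0) to (b*n, m):
-- component i (0-indexed, i.e. the paper's p_{i+1}) is the path from
-- (0,0) to (n,m) with height sequence (h_{k*b+i+1})_{k=0}^{n-1}
-- (1-indexed h as in the paper).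
θh : (b n m : ℕ) → Path → Fin b → Path
θh b n m π i = fromHeights m (map (λ k → nth (heightSeq π) (k * b + toℕ i)) (upTo n))

-- Vertical strip decomposition of a path from (0,0) to (m, a*n):
-- component j (0-indexed) is the path from (0,0) to (m,n) with step
-- sequence (u_{k*a+j+1})_{k=0}^{n-1}.
θv : (a n m : ℕ) → Path → Fin a → Path
θv a n m π j = fromSteps m (map (λ k → nth (stepSeq π) (k * a + toℕ j)) (upTo n))

-- (a,b)-Dyck path of size n: from (0,0) to (b*n, a*n), never below
-- y = a x / b, i.e. every prefix endpoint (x,y) satisfies a*x ≤ b*y.
record IsDyck (a b n : ℕ) (π : Path) : Set where
  field
    east  : #E π ≡ b * n
    north : #N π ≡ a * n
    above : ∀ k → a * #E (take k π) ≤ b * #N (take k π)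

{-# OPTIONS --safe #-}
module Submission where

-- The i-th path of θh(π) is π with every east step deleted except those whose
-- index is ≡ i (mod b): it has the same north steps and the selected heights.
-- Dually the j-th path of θv(π) deletes all north steps but those of index
-- ≡ j (mod a). Both composites therefore delete the same steps of π, and
-- deleting east steps commutes with deleting north steps. Reflection in the
-- diagonal (swapping N and E) turns θh into θv, so only θv is analysed
-- directly.

open import Defs
open import Data.Nat using (ℕ; zero; suc; _+_; _*_; _∸_; _≤_; _<_; s≤s; pred)
open import Data.Nat.Properties
open import Data.Nat.Coprimality using (Coprime)
open import Data.Fin using (Fin; toℕ)
open import Data.Fin.Properties using (toℕ<n)
open import Data.List using (List; []; _∷_; _++_; map; replicate; upTo; applyUpTo; length)
open import Data.List.Properties using (map-++; map-replicate; map-upTo)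
open import Data.List.Relation.Unary.All as All using (All; []; _∷_)
open import Function using (_∘_)
open import Relation.Binary.PropositionalEquality

flipStep : Step → Step
flipStep N = E
flipStep E = N

transpose : Path → Path
transpose = map flipStep

#E-transpose : ∀ p → #E (transpose p) ≡ #N p
#E-transpose [] = refl
#E-transpose (N ∷ p) = cong suc (#E-transpose p)
#E-transpose (E ∷ p) = #E-transpose p

#N-transpose : ∀ p → #N (transpose p) ≡ #E p
#N-transpose [] = refl
#N-transpose (N ∷ p) = #N-transpose p
#N-transpose (E ∷ p) = cong suc (#N-transpose p)

heightSeqFrom-transpose : ∀ y p → heightSeqFrom y p ≡ stepSeqFrom y (transpose p)
heightSeqFrom-transpose y [] = refl
heightSeqFrom-transpose y (N ∷ p) = heightSeqFrom-transpose (suc y) p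
heightSeqFrom-transpose y (E ∷ p) = cong (y ∷_) (heightSeqFrom-transpose y p)

fromHeightsFrom-transpose : ∀ m c hs → fromHeightsFrom m c hs ≡ transpose (fromStepsFrom m c hs)
fromHeightsFrom-transpose m c [] = sym (map-replicate flipStep (m ∸ c) E)
fromHeightsFrom-transpose m c (h ∷ hs) = begin
  replicate (h ∸ c) N ++ E ∷ fromHeightsFrom m h hs
    ≡⟨ cong (λ q → replicate (h ∸ c) N ++ E ∷ q) (fromHeightsFrom-transpose m h hs) ⟩
  replicate (h ∸ c) N ++ transpose (N ∷ fromStepsFrom m h hs)
    ≡⟨ cong (_++ _) (sym (map-replicate flipStep (h ∸ c) E)) ⟩
  transpose (replicate (h ∸ c) E) ++ transpose (N ∷ fromStepsFrom m h hs)
    ≡⟨ sym (map-++ flipStep (replicate (h ∸ c) E) _) ⟩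
  transpose (fromStepsFrom m c (h ∷ hs)) ∎
  where open ≡-Reasoning

θh-transpose : ∀ b n m π (i : Fin b) → θh b n m π i ≡ transpose (θv b n m (transpose π) i)
θh-transpose b n m π i rewrite heightSeqFrom-transpose 0 π =
  fromHeightsFrom-transpose m 0 (map (λ k → nth (stepSeq (transpose π)) (k * b + toℕ i)) (upTo n))

-- takeEvery b c xs lists the entries of xs at indices c, c + b, c + 2b, …
-- (for c < b); the counter c is the number of entries still to skip before
-- the next one kept. countEvery b c L is the length of the result for
-- |xs| = L.
takeEvery : ℕ → ℕ → List ℕ → List ℕ
takeEvery b c [] = []
takeEvery b zero (x ∷ xs) = x ∷ takeEvery b (pred b) xs
takeEvery b (suc c) (x ∷ xs) = takeEvery b c xs

countEvery : ℕ → ℕ → ℕ → ℕ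
countEvery b c zero = 0
countEvery b zero (suc L) = suc (countEvery b (pred b) L)
countEvery b (suc c) (suc L) = countEvery b c L

applyUpTo-cong : ∀ {f g : ℕ → ℕ} n → (∀ k → f k ≡ g k) → applyUpTo f n ≡ applyUpTo g n
applyUpTo-cong zero f≗g = refl
applyUpTo-cong (suc n) f≗g = cong₂ _∷_ (f≗g 0) (applyUpTo-cong n (f≗g ∘ suc))

takeEvery-applyUpTo : ∀ b' c xs →
  takeEvery (suc b') c xs ≡ applyUpTo (λ k → nth xs (k * suc b' + c)) (countEvery (suc b') c (length xs))
takeEvery-applyUpTo b' c [] = refl
takeEvery-applyUpTo b' (suc c) (x ∷ xs) = trans (takeEvery-applyUpTo b' c xs)
  (applyUpTo-cong _ λ k → cong (nth (x ∷ xs)) (sym (+-suc (k * suc b') c)))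
takeEvery-applyUpTo b' zero (x ∷ xs) = cong (x ∷_) (trans (takeEvery-applyUpTo b' b' xs)
  (applyUpTo-cong _ λ k → cong (nth xs) (sym (trans (+-identityʳ (b' + k * suc b')) (+-comm b' (k * suc b'))))))

countEvery-+ : ∀ b c t L → countEvery b (c + t) (c + L) ≡ countEvery b t L
countEvery-+ b zero t L = refl
countEvery-+ b (suc c) t L = countEvery-+ b c t L

countEvery-* : ∀ b' n {i} → i < suc b' → countEvery (suc b') i (suc b' * n) ≡ n
countEvery-* b' zero {i} _ = cong (countEvery (suc b') i) (*-zeroʳ b')
countEvery-* b' (suc n) {i} (s≤s i≤b') = begin
  countEvery B i (B * suc n)               ≡⟨ cong₂ (countEvery B) (sym (+-identityʳ i)) split ⟩
  countEvery B (i + 0) (i + suc (d + B * n)) ≡⟨ countEvery-+ B i 0 _ ⟩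
  suc (countEvery B b' (d + B * n))        ≡⟨ cong (λ c → suc (countEvery B c (d + B * n))) b'≡d+i ⟩
  suc (countEvery B (d + i) (d + B * n))   ≡⟨ cong suc (countEvery-+ B d i (B * n)) ⟩
  suc (countEvery B i (B * n))             ≡⟨ cong suc (countEvery-* b' n (s≤s i≤b')) ⟩
  suc n                                    ∎
  where
  open ≡-Reasoning
  B = suc b'
  d = b' ∸ i
  b'≡d+i : b' ≡ d + i
  b'≡d+i = sym (m∸n+n≡m i≤b')
  split : B * suc n ≡ i + suc (d + B * n)
  split = begin
    B * suc n               ≡⟨ *-suc B n ⟩
    suc (b' + B * n)        ≡⟨ cong (λ c → suc (c + B * n)) (trans b'≡d+i (+-comm d i)) ⟩
    suc (i + d + B * n)     ≡⟨ cong suc (+-assoc i d (B * n)) ⟩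
    suc (i + (d + B * n))   ≡⟨ sym (+-suc i (d + B * n)) ⟩
    i + suc (d + B * n)     ∎

-- thinN b c p deletes the north steps of p except those of index c, c + b,
-- c + 2b, … (counter convention as for takeEvery); thinE does the same to
-- east steps.
thinN : ℕ → ℕ → Path → Path
thinN b c [] = []
thinN b c (E ∷ p) = E ∷ thinN b c p
thinN b zero (N ∷ p) = N ∷ thinN b (pred b) p
thinN b (suc c) (N ∷ p) = thinN b c p

thinE : ℕ → ℕ → Path → Path
thinE b c = transpose ∘ thinN b c ∘ transpose

thinN-thinE-comm : ∀ a b j i p → thinN a j (thinE b i p) ≡ thinE b i (thinN a j p)
thinN-thinE-comm a b j i [] = refl
thinN-thinE-comm a b zero i (N ∷ p) = cong (N ∷_) (thinN-thinE-comm a b (pred a) i p)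
thinN-thinE-comm a b (suc j) i (N ∷ p) = thinN-thinE-comm a b j i p
thinN-thinE-comm a b j zero (E ∷ p) = cong (E ∷_) (thinN-thinE-comm a b j (pred b) p)
thinN-thinE-comm a b j (suc i) (E ∷ p) = thinN-thinE-comm a b j i p

stepSeqFrom-thinN : ∀ b c y p → stepSeqFrom y (thinN b c p) ≡ takeEvery b c (stepSeqFrom y p)
stepSeqFrom-thinN b c y [] = refl
stepSeqFrom-thinN b c y (E ∷ p) = stepSeqFrom-thinN b c (suc y) p
stepSeqFrom-thinN b zero y (N ∷ p) = cong (y ∷_) (stepSeqFrom-thinN b (pred b) y p)
stepSeqFrom-thinN b (suc c) y (N ∷ p) = stepSeqFrom-thinN b c y p

#N-thinN : ∀ b c p → #N (thinN b c p) ≡ countEvery b c (#N p)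
#N-thinN b c [] = refl
#N-thinN b c (E ∷ p) = #N-thinN b c p
#N-thinN b zero (N ∷ p) = cong suc (#N-thinN b (pred b) p)
#N-thinN b (suc c) (N ∷ p) = #N-thinN b c p

#E-thinN : ∀ b c p → #E (thinN b c p) ≡ #E p
#E-thinN b c [] = refl
#E-thinN b c (E ∷ p) = cong suc (#E-thinN b c p)
#E-thinN b zero (N ∷ p) = #E-thinN b (pred b) p
#E-thinN b (suc c) (N ∷ p) = #E-thinN b c p

#E-thinE : ∀ b c p → #E (thinE b c p) ≡ countEvery b c (#E p)
#E-thinE b c p = begin
  #E (transpose (thinN b c (transpose p))) ≡⟨ #E-transpose (thinN b c (transpose p)) ⟩
  #N (thinN b c (transpose p))             ≡⟨ #N-thinN b c (transpose p) ⟩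
  countEvery b c (#N (transpose p))        ≡⟨ cong (countEvery b c) (#N-transpose p) ⟩
  countEvery b c (#E p)                    ∎
  where open ≡-Reasoning

#N-thinE : ∀ b c p → #N (thinE b c p) ≡ #N p
#N-thinE b c p = begin
  #N (transpose (thinN b c (transpose p))) ≡⟨ #N-transpose (thinN b c (transpose p)) ⟩
  #E (thinN b c (transpose p))             ≡⟨ #E-thinN b c (transpose p) ⟩
  #E (transpose p)                         ≡⟨ #E-transpose p ⟩
  #N p                                     ∎
  where open ≡-Reasoning

length-stepSeqFrom : ∀ y p → length (stepSeqFrom y p) ≡ #N p
length-stepSeqFrom y [] = refl
length-stepSeqFrom y (E ∷ p) = length-stepSeqFrom (suc y) p
length-stepSeqFrom y (N ∷ p) = cong suc (length-stepSeqFrom y p)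

stepSeqFrom-≥ : ∀ y p → All (y ≤_) (stepSeqFrom y p)
stepSeqFrom-≥ y [] = []
stepSeqFrom-≥ y (N ∷ p) = ≤-refl ∷ stepSeqFrom-≥ y p
stepSeqFrom-≥ y (E ∷ p) = All.map <⇒≤ (stepSeqFrom-≥ (suc y) p)

∸≡suc∸suc : ∀ m c → suc c ≤ m → m ∸ c ≡ suc (m ∸ suc c)
∸≡suc∸suc (suc m) zero _ = refl
∸≡suc∸suc (suc m) (suc c) (s≤s c<m) = ∸≡suc∸suc m c c<m

fromStepsFrom-suc : ∀ m c us → All (suc c ≤_) us → suc c ≤ m →
  fromStepsFrom m c us ≡ E ∷ fromStepsFrom m (suc c) us
fromStepsFrom-suc m c [] _ c<m rewrite ∸≡suc∸suc m c c<m = refl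
fromStepsFrom-suc m c (u ∷ us) (c<u ∷ _) _ rewrite ∸≡suc∸suc u c c<u = refl

fromStepsFrom-stepSeqFrom : ∀ c p → fromStepsFrom (c + #E p) c (stepSeqFrom c p) ≡ p
fromStepsFrom-stepSeqFrom c [] = cong (λ k → replicate k E) (m+n∸m≡n c 0)
fromStepsFrom-stepSeqFrom c (N ∷ p) rewrite n∸n≡0 c = cong (N ∷_) (fromStepsFrom-stepSeqFrom c p)
fromStepsFrom-stepSeqFrom c (E ∷ p) rewrite +-suc c (#E p) =
  trans (fromStepsFrom-suc (suc c + #E p) c _ (stepSeqFrom-≥ (suc c) p) (s≤s (m≤m+n c (#E p))))
        (cong (E ∷_) (fromStepsFrom-stepSeqFrom (suc c) p))

countEvery-stripes : ∀ a' n {L} → L ≡ suc a' * n → (j : Fin (suc a')) → countEvery (suc a') (toℕ j) L ≡ n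
countEvery-stripes a' n refl j = countEvery-* a' n (toℕ<n j)

θv-thinN : ∀ a' n {m} π (j : Fin (suc a')) → #E π ≡ m → #N π ≡ suc a' * n →
  θv (suc a') n m π j ≡ thinN (suc a') (toℕ j) π
θv-thinN a' n {m} π j #E≡m #N≡ = begin
  fromSteps m (map f (upTo n))                   ≡⟨ cong (fromSteps m) (map-upTo f n) ⟩
  fromSteps m (applyUpTo f n)                    ≡⟨ cong (fromSteps m ∘ applyUpTo f) (sym stripes) ⟩
  fromSteps m (applyUpTo f (countEvery A c (length (stepSeq π))))
                                                 ≡⟨ cong (fromSteps m) (sym (takeEvery-applyUpTo a' c (stepSeq π))) ⟩
  fromSteps m (takeEvery A c (stepSeq π))        ≡⟨ cong (fromSteps m) (sym (stepSeqFrom-thinN A c 0 π)) ⟩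
  fromSteps m (stepSeq π′)                       ≡⟨ cong (λ k → fromSteps k (stepSeq π′)) (sym (trans (#E-thinN A c π) #E≡m)) ⟩
  fromSteps (#E π′) (stepSeq π′)                 ≡⟨ fromStepsFrom-stepSeqFrom 0 π′ ⟩
  π′                                             ∎
  where
  open ≡-Reasoning
  A = suc a'
  c = toℕ j
  f = λ k → nth (stepSeq π) (k * A + c)
  π′ = thinN A c π
  stripes : countEvery A c (length (stepSeq π)) ≡ n
  stripes = countEvery-stripes a' n (trans (length-stepSeqFrom 0 π) #N≡) j

θh-thinE : ∀ b' n {m} π (i : Fin (suc b')) → #N π ≡ m → #E π ≡ suc b' * n →
  θh (suc b') n m π i ≡ thinE (suc b') (toℕ i) π
θh-thinE b' n {m} π i #N≡m #E≡ = begin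
  θh (suc b') n m π i                                 ≡⟨ θh-transpose (suc b') n m π i ⟩
  transpose (θv (suc b') n m (transpose π) i)         ≡⟨ cong transpose (θv-thinN b' n (transpose π) i
                                                           (trans (#E-transpose π) #N≡m) (trans (#N-transpose π) #E≡)) ⟩
  thinE (suc b') (toℕ i) π                            ∎
  where open ≡-Reasoning

mainTheorem3 : (a b n : ℕ) → 1 ≤ a → 1 ≤ b → Coprime a b → 1 ≤ n →
    (π : Path) → IsDyck a b n π →
    (i : Fin b) (j : Fin a) →
    θv a n n (θh b n (a * n) π i) j ≡ θh b n n (θv a n (b * n) π j) i
mainTheorem3 (suc a') (suc b') n _ _ _ _ π dyck i j = begin
  θv A n n (θh B n (A * n) π i) j  ≡⟨ cong (λ p → θv A n n p j) (θh-thinE b' n π i north east) ⟩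
  θv A n n πE j                    ≡⟨ θv-thinN a' n πE j #E-πE (trans (#N-thinE B (toℕ i) π) north) ⟩
  thinN A (toℕ j) πE               ≡⟨ thinN-thinE-comm A B (toℕ j) (toℕ i) π ⟩
  thinE B (toℕ i) πN               ≡⟨ sym (θh-thinE b' n πN i #N-πN (trans (#E-thinN A (toℕ j) π) east)) ⟩
  θh B n n πN i                    ≡⟨ cong (λ p → θh B n n p i) (sym (θv-thinN a' n π j east north)) ⟩
  θh B n n (θv A n (B * n) π j) i  ∎
  where
  open ≡-Reasoning
  open IsDyck dyck
  A = suc a'
  B = suc b'
  πE = thinE B (toℕ i) π
  πN = thinN A (toℕ j) π
  #E-πE : #E πE ≡ n
  #E-πE = trans (#E-thinE B (toℕ i) π) (countEvery-stripes b' n east i)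
  #N-πN : #N πN ≡ n
  #N-πN = trans (#N-thinN A (toℕ j) π) (countEvery-stripes a' n north j)
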